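{- Let $T$ be a tree on a finite set $I$. Let $a_1,\dots,a_k$ be atoms of the lattice $[\hat 0,T]$ whose associated vertices $v_1,\dots,v_k\in\mathcal V(T)$ are pairwise distinct. Then $\mathcal V(a_1\vee a_2\vee\cdots\vee a_k)=\{v_1,\dots,v_k\}$, where the join is taken in $[\hat 0,T]$.
   Context: A tree on a finite set $I$ is a rooted binary tree (not considered as planar) whose leaves are bijectively labeled by $I$: every vertex is either an inner vertex of valence 3, or a vertex of valence 1 (a leaf or the root); edges are oriented towards the root. A forest on $I$ is a set of trees on pairwise disjoint label sets whose union is $I$; $\mathcal V(F)$ denotes its set of inner vertices. For forests $F,G$ on $I$, $F\le G$ means there is a continuous map from $F$ to $G$ such that: (D1) it is increasing with respect to the orientation towards the root; (D2) it maps inner vertices to inner vertices injectively; (D3) it restricts to the identity of $I$ on leaves; (D4) its restriction to each tree of $F$ is injective. This is a partial order on the set $\operatorname{For}(I)$ of forests on $I$, graded by the number of inner vertices, with minimum $\hat 0$ the forest with no inner vertices; the interval $[\hat 0,T]$ is a lattice. For distinct leaves $i,j$ of $T$, $v_{(i,j)}$ is the inner vertex of $T$ where the paths from $i$ and $j$ to the root meet; for $J\subseteq I$, $\mathcal S(J)=\{v_{(i,j)}: i\ne j\in J\}$. For $F\in[\hat 0,T]$ whose trees have leaf sets $\pi_1,\dots,\pi_k$, the inner vertices of $F$ are identified with their images in $T$, so that $\mathcal V(F)=\mathcal S(\pi_1)\cup\dots\cup\mathcal S(\pi_k)\subseteq\mathcal V(T)$. The atoms of $[\hat 0,T]$ are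 the forests with exactly one inner vertex, i.e. those whose only non-trivial tree has two leaves $i\ne j$; the vertex associated with such an atom is $v_{(i,j)}$. -}

module Defs where

open import Data.Nat using (ℕ)
open import Data.Fin using (Fin; _≟_)
open import Data.List using (List; []; _∷_; _++_; length; lookup; concatMap; map; filter; [_]; allFin)
open import Data.List.Relation.Binary.Permutation.Propositional using (_↭_)
open import Data.Product using (Σ; Σ-syntax; _×_; _,_; proj₁)
open import Data.Sum using (_⊎_)
open import Relation.Nullary using (¬_; ¬?)
open import Relation.Nullary.Decidable using (_×-dec_)
open import Relation.Binary.PropositionalEquality using (_≡_)

-- The datatype is planar; non-planarity is irrelevant because the order
-- on forests is defined through maps (D1)-(D4), never via equality.
data Tree (n : ℕ) : Set where
  leaf : Fin n → Tree n
  node : Tree n → Tree n → Tree n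

Forest : ℕ → Set
Forest n = List (Tree n)

module _ {n : ℕ} where

  leaves : Tree n → List (Fin n)
  leaves (leaf i)   = [ i ]
  leaves (node l r) = leaves l ++ leaves r

  IsTreeOn : Tree n → Set
  IsTreeOn t = leaves t ↭ allFin n

  IsForestOn : Forest n → Set
  IsForestOn F = concatMap leaves F ↭ allFin n

  zeroF : Forest n
  zeroF = map leaf (allFin n)

  atom : Fin n → Fin n → Forest n
  atom i j = node (leaf i) (leaf j)
           ∷ map leaf (filter (λ m → ¬? (m ≟ i) ×-dec ¬? (m ≟ j)) (allFin n))

  -- vertices (inner vertices and leaves) of a tree, as paths from the top vertex
  data Pos : Tree n → Set where
    here  : ∀ {t} → Pos t
    left  : ∀ {l r} → Pos l → Pos (node l r)
    right : ∀ {l r} → Pos r → Pos (node l r)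

  subtreeAt : (t : Tree n) → Pos t → Tree n
  subtreeAt t          here      = t
  subtreeAt (node l r) (left p)  = subtreeAt l p
  subtreeAt (node l r) (right p) = subtreeAt r p

  data IsNode : Tree n → Set where
    isNode : ∀ {l r} → IsNode (node l r)

  data InL : {t : Tree n} → Pos t → Pos t → Set where
    inL-here  : ∀ {l r} {q : Pos l} → InL {node l r} here (left q)
    inL-left  : ∀ {l r} {p q : Pos l} → InL p q → InL {node l r} (left p) (left q)
    inL-right : ∀ {l r} {p q : Pos r} → InL p q → InL {node l r} (right p) (right q)

  data InR : {t : Tree n} → Pos t → Pos t → Set where
    inR-here  : ∀ {l r} {q : Pos r} → InR {node l r} here (right q)
    inR-left  : ∀ {l r} {p q : Pos l} → InR p q → InR {node l r} (left p) (left q)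
    inR-right : ∀ {l r} {p q : Pos r} → InR p q → InR {node l r} (right p) (right q)

  data ChildL : {t : Tree n} → Pos t → Pos t → Set where
    cl-here  : ∀ {l r} → ChildL {node l r} here (left here)
    cl-left  : ∀ {l r} {p q : Pos l} → ChildL p q → ChildL {node l r} (left p) (left q)
    cl-right : ∀ {l r} {p q : Pos r} → ChildL p q → ChildL {node l r} (right p) (right q)

  data ChildR : {t : Tree n} → Pos t → Pos t → Set where
    cr-here  : ∀ {l r} → ChildR {node l r} here (right here)
    cr-left  : ∀ {l r} {p q : Pos l} → ChildR p q → ChildR {node l r} (left p) (left q)
    cr-right : ∀ {l r} {p q : Pos r} → ChildR p q → ChildR {node l r} (right p) (right q)

  FPos : Forest n → Set
  FPos F = Σ (Fin (length F)) (λ k → Pos (lookup F k))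

  FSub : (F : Forest n) → FPos F → Tree n
  FSub F (k , p) = subtreeAt (lookup F k) p

  data FInL (F : Forest n) : FPos F → FPos F → Set where
    mk : ∀ {k} {p q : Pos (lookup F k)} → InL p q → FInL F (k , p) (k , q)

  data FInR (F : Forest n) : FPos F → FPos F → Set where
    mk : ∀ {k} {p q : Pos (lookup F k)} → InR p q → FInR F (k , p) (k , q)

  data FChildL (F : Forest n) : FPos F → FPos F → Set where
    mk : ∀ {k} {p q : Pos (lookup F k)} → ChildL p q → FChildL F (k , p) (k , q)

  data FChildR (F : Forest n) : FPos F → FPos F → Set where
    mk : ∀ {k} {p q : Pos (lookup F k)} → ChildR p q → FChildR F (k , p) (k , q)

  -- Combinatorial form of a map F → G satisfying (D1)-(D4):
  -- (D3) leaves go to the equally labelled leaves;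
  -- (D2) inner vertices go injectively to inner vertices;
  -- (D1)+(D4) the two child edges of an inner vertex x are mapped to upward
  --   paths ending at φ x which enter φ x through its two different children
  --   (this is exactly continuity + monotonicity + injectivity on each tree).
  record IsMorphism (F G : Forest n) (φ : FPos F → FPos G) : Set where
    field
      onLeaves : ∀ x i → FSub F x ≡ leaf i → FSub G (φ x) ≡ leaf i
      onInner  : ∀ x → IsNode (FSub F x) → IsNode (FSub G (φ x))
      innerInj : ∀ x y → IsNode (FSub F x) → IsNode (FSub F y) → φ x ≡ φ y → x ≡ y
      onEdges  : ∀ x cl cr → FChildL F x cl → FChildR F x cr →
                   (FInL G (φ x) (φ cl) × FInR G (φ x) (φ cr))
                 ⊎ (FInR G (φ x) (φ cl) × FInL G (φ x) (φ cr))

  _≤F_ : Forest n → Forest n → Set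
  F ≤F G = Σ (FPos F → FPos G) (IsMorphism F G)

  InInterval : Tree n → Forest n → Set
  InInterval T F = IsForestOn F × zeroF ≤F F × F ≤F [ T ]

  IsJoinIn : ∀ {k} → Tree n → (Fin k → Forest n) → Forest n → Set
  IsJoinIn T as J =
    InInterval T J × (∀ r → as r ≤F J)
    × (∀ F → InInterval T F → (∀ r → as r ≤F F) → J ≤F F)

  -- x is the vertex v_(i,j) of T (seen as the one-tree forest [ T ]):
  -- the inner vertex where the paths from leaves i and j to the root meet
  IsVertex : (T : Tree n) → Fin n → Fin n → FPos [ T ] → Set
  IsVertex T i j x =
    Σ (FPos [ T ]) λ y → Σ (FPos [ T ]) λ z →
      FSub [ T ] y ≡ leaf i × FSub [ T ] z ≡ leaf j ×
      ((FInL [ T ] x y × FInR [ T ] x z) ⊎ (FInR [ T ] x y × FInL [ T ] x z))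

{-# OPTIONS --safe #-}
-- The join J₀ is assembled bottom-up along T. At an inner vertex v the forests built
-- for its two subtrees are juxtaposed, unless v = v_s for some s (unique, as the v_s
-- are distinct); then the tree containing i_s on one side and the tree containing j_s
-- on the other are grafted onto a new root. Every tree of J₀ is placed in T with each
-- inner vertex sent to some v_s, and every v_s is hit, so J₀ ∈ [0̂,T] lies above all
-- atoms. If F ∈ [0̂,T] lies above the atoms, sending the vertex of J₀ over v_s to the
-- image in F of the root of a_s gives J₀ ≤ F: composed with F → T it is the placement
-- of J₀ in T, which forces the required forks in F. Finally, a morphism into T is
-- determined by the images of the leaves, so for any join J the map J → T factors as
-- J → J₀ → T, and the inner vertices of J land exactly on v_1, …, v_k.
module Submission where

open import Defs
import Algebra.Solver.CommutativeMonoid as CommutativeMonoidSolver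
open import Data.Empty using (⊥; ⊥-elim)
open import Data.Fin using (Fin; zero; suc; _≟_)
open import Data.Fin.Properties using (any?)
open import Data.List using (List; []; _∷_; _++_; [_]; length; lookup; concatMap; map; filter; allFin)
open import Data.List.Properties using (concatMap-++; ++-identityʳ)
open import Data.List.Membership.Propositional using (_∈_)
open import Data.List.Membership.Propositional.Properties using (∈-++⁺ˡ; ∈-++⁺ʳ; ∈-++⁻; ∈-allFin; ∈-concat⁻′; ∈-map⁻; ∈-∃++; ∈-lookup)
open import Data.List.Relation.Unary.All as All using (All; []; _∷_)
import Data.List.Relation.Unary.All.Properties as Allₚ
open import Data.List.Relation.Unary.AllPairs using ([]; _∷_)
open import Data.List.Relation.Unary.Any as Any using (Any)
import Data.List.Relation.Unary.Any.Properties as Anyₚ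
open import Data.List.Relation.Unary.Unique.Propositional using (Unique)
open import Data.List.Relation.Unary.Unique.Propositional.Properties using (allFin⁺)
open import Data.List.Relation.Binary.Permutation.Propositional using (_↭_; ↭-sym; ↭-trans; ↭-refl; ↭-reflexive; ↭⇒↭ₛ; module PermutationReasoning)
open import Data.List.Relation.Binary.Permutation.Propositional.Properties using (∈-resp-↭; ++⁺; ++-commutativeMonoid)
import Data.List.Relation.Binary.Permutation.Setoid.Properties as PermutationSetoid
open import Data.Nat using (ℕ)
open import Data.Product as Product using (Σ; _×_; _,_; proj₁; proj₂)
open import Data.Sum as Sum using (_⊎_; inj₁; inj₂)
open import Function using (id)
open import Function.Bundles using (_⇔_; mk⇔)
open import Relation.Binary.Construct.Closure.ReflexiveTransitive using (Star; ε; _◅_; gmap)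
open import Relation.Binary.PropositionalEquality using (_≡_; _≢_; refl; sym; trans; cong; cong₂; subst; subst₂; setoid)
open import Relation.Nullary using (Dec; yes; no; ¬_; ¬?)
open import Relation.Nullary.Decidable using (_×-dec_; _⊎-dec_)

private
  variable
    n : ℕ
    a b : Fin n
    t l r : Tree n
    p q w c : Pos t
    F G H : Forest n

-- Positions in a tree

data Desc {n : ℕ} : {t : Tree n} → Pos t → Pos t → Set where
  d-here  : Desc {t = t} here q
  d-left  : Desc p q → Desc {t = node l r} (left p) (left q)
  d-right : Desc p q → Desc {t = node l r} (right p) (right q)

Strict : Pos t → Pos t → Set
Strict p q = InL p q ⊎ InR p q

Fork : Pos t → Pos t → Pos t → Set
Fork w p q = (InL w p × InR w q) ⊎ (InR w p × InL w q)

Child : Pos t → Pos t → Set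
Child p c = ChildL p c ⊎ ChildR p c

Meet : (t : Tree n) → Fin n → Fin n → Pos t → Set
Meet t a b w = Σ (Pos t) λ p → Σ (Pos t) λ q →
  subtreeAt t p ≡ leaf a × subtreeAt t q ≡ leaf b × Fork w p q

HasMeet : Fin n → Fin n → Tree n → Set
HasMeet a b t = Σ (Pos t) (Meet t a b)

desc-refl : (p : Pos t) → Desc p p
desc-refl here      = d-here
desc-refl (left p)  = d-left (desc-refl p)
desc-refl (right p) = d-right (desc-refl p)

desc-trans : Desc p q → Desc q w → Desc p w
desc-trans d-here      _           = d-here
desc-trans (d-left d)  (d-left e)  = d-left (desc-trans d e)
desc-trans (d-right d) (d-right e) = d-right (desc-trans d e)

desc-linear : Desc p w → Desc q w → Desc p q ⊎ Desc q p
desc-linear d-here      _           = inj₁ d-here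
desc-linear (d-left _)  d-here      = inj₂ d-here
desc-linear (d-right _) d-here      = inj₂ d-here
desc-linear (d-left d)  (d-left e)  = Sum.map d-left d-left (desc-linear d e)
desc-linear (d-right d) (d-right e) = Sum.map d-right d-right (desc-linear d e)

inL⇒desc : InL p q → Desc p q
inL⇒desc inL-here      = d-here
inL⇒desc (inL-left x)  = d-left (inL⇒desc x)
inL⇒desc (inL-right x) = d-right (inL⇒desc x)

inR⇒desc : InR p q → Desc p q
inR⇒desc inR-here      = d-here
inR⇒desc (inR-left x)  = d-left (inR⇒desc x)
inR⇒desc (inR-right x) = d-right (inR⇒desc x)

inL-desc-trans : InL p q → Desc q w → InL p w
inL-desc-trans inL-here      (d-left _)  = inL-here
inL-desc-trans (inL-left x)  (d-left d)  = inL-left (inL-desc-trans x d)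
inL-desc-trans (inL-right x) (d-right d) = inL-right (inL-desc-trans x d)

inR-desc-trans : InR p q → Desc q w → InR p w
inR-desc-trans inR-here      (d-right _) = inR-here
inR-desc-trans (inR-left x)  (d-left d)  = inR-left (inR-desc-trans x d)
inR-desc-trans (inR-right x) (d-right d) = inR-right (inR-desc-trans x d)

strict⇒¬desc : Strict p q → Desc q p → ⊥
strict⇒¬desc (inj₁ inL-here)      ()
strict⇒¬desc (inj₁ (inL-left x))  (d-left d)  = strict⇒¬desc (inj₁ x) d
strict⇒¬desc (inj₁ (inL-right x)) (d-right d) = strict⇒¬desc (inj₁ x) d
strict⇒¬desc (inj₂ inR-here)      ()
strict⇒¬desc (inj₂ (inR-left x))  (d-left d)  = strict⇒¬desc (inj₂ x) d
strict⇒¬desc (inj₂ (inR-right x)) (d-right d) = strict⇒¬desc (inj₂ x) d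

inL⇒¬inR : InL p q → InR p q → ⊥
inL⇒¬inR inL-here      ()
inL⇒¬inR (inL-left x)  (inR-left y)  = inL⇒¬inR x y
inL⇒¬inR (inL-right x) (inR-right y) = inL⇒¬inR x y

desc⇒≡⊎strict : Desc p q → p ≡ q ⊎ Strict p q
desc⇒≡⊎strict {q = here}    d-here = inj₁ refl
desc⇒≡⊎strict {q = left _}  d-here = inj₂ (inj₁ inL-here)
desc⇒≡⊎strict {q = right _} d-here = inj₂ (inj₂ inR-here)
desc⇒≡⊎strict (d-left d)  = Sum.map (cong left) (Sum.map inL-left inR-left) (desc⇒≡⊎strict d)
desc⇒≡⊎strict (d-right d) = Sum.map (cong right) (Sum.map inL-right inR-right) (desc⇒≡⊎strict d)

inL⇒node : InL p q → IsNode (subtreeAt t p)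
inL⇒node inL-here      = isNode
inL⇒node (inL-left x)  = inL⇒node x
inL⇒node (inL-right x) = inL⇒node x

childL⇒node : ChildL p c → IsNode (subtreeAt t p)
childL⇒node cl-here      = isNode
childL⇒node (cl-left h)  = childL⇒node h
childL⇒node (cl-right h) = childL⇒node h

isNode⇒≢leaf : IsNode t → t ≢ leaf a
isNode⇒≢leaf isNode ()

childL-desc⇒inL : ChildL p c → Desc c q → InL p q
childL-desc⇒inL cl-here      (d-left _)  = inL-here
childL-desc⇒inL (cl-left h)  (d-left d)  = inL-left (childL-desc⇒inL h d)
childL-desc⇒inL (cl-right h) (d-right d) = inL-right (childL-desc⇒inL h d)

childR-desc⇒inR : ChildR p c → Desc c q → InR p q
childR-desc⇒inR cr-here      (d-right _) = inR-here
childR-desc⇒inR (cr-left h)  (d-left d)  = inR-left (childR-desc⇒inR h d)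
childR-desc⇒inR (cr-right h) (d-right d) = inR-right (childR-desc⇒inR h d)

childL⇒desc : ChildL p c → Desc p c
childL⇒desc {c = c} h = inL⇒desc (childL-desc⇒inL h (desc-refl c))

childR⇒desc : ChildR p c → Desc p c
childR⇒desc {c = c} h = inR⇒desc (childR-desc⇒inR h (desc-refl c))

inL⇒childL : InL p q → Σ (Pos t) λ c → ChildL p c × Desc c q
inL⇒childL inL-here      = left here , cl-here , d-left d-here
inL⇒childL (inL-left x)  = Product.map left (Product.map cl-left d-left) (inL⇒childL x)
inL⇒childL (inL-right x) = Product.map right (Product.map cl-right d-right) (inL⇒childL x)

inR⇒childR : InR p q → Σ (Pos t) λ c → ChildR p c × Desc c q
inR⇒childR inR-here      = right here , cr-here , d-right d-here
inR⇒childR (inR-left x)  = Product.map left (Product.map cr-left d-left) (inR⇒childR x)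
inR⇒childR (inR-right x) = Product.map right (Product.map cr-right d-right) (inR⇒childR x)

childL⇒childR : ChildL p c → Σ (Pos t) (ChildR p)
childL⇒childR cl-here      = right here , cr-here
childL⇒childR (cl-left h)  = Product.map left cr-left (childL⇒childR h)
childL⇒childR (cl-right h) = Product.map right cr-right (childL⇒childR h)

childR⇒childL : ChildR p c → Σ (Pos t) (ChildL p)
childR⇒childL cr-here      = left here , cl-here
childR⇒childL (cr-left h)  = Product.map left cl-left (childR⇒childL h)
childR⇒childL (cr-right h) = Product.map right cl-right (childR⇒childL h)

childL-at : (p : Pos t) → subtreeAt t p ≡ node l r → Σ (Pos t) λ c → ChildL p c × subtreeAt t c ≡ l
childL-at here refl = left here , cl-here , refl
childL-at {t = node _ _} (left p)  e = Product.map left (Product.map₁ cl-left) (childL-at p e)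
childL-at {t = node _ _} (right p) e = Product.map right (Product.map₁ cl-right) (childL-at p e)

childR-at : (p : Pos t) → subtreeAt t p ≡ node l r → Σ (Pos t) λ c → ChildR p c × subtreeAt t c ≡ r
childR-at here refl = right here , cr-here , refl
childR-at {t = node _ _} (left p)  e = Product.map left (Product.map₁ cr-left) (childR-at p e)
childR-at {t = node _ _} (right p) e = Product.map right (Product.map₁ cr-right) (childR-at p e)

here⇒star : (q : Pos t) → Star Child here q
here⇒star here      = ε
here⇒star (left q)  = inj₁ cl-here ◅ gmap left (Sum.map cl-left cr-left) (here⇒star q)
here⇒star (right q) = inj₂ cr-here ◅ gmap right (Sum.map cl-right cr-right) (here⇒star q)

desc⇒star : Desc p q → Star Child p q
desc⇒star {q = q} d-here = here⇒star q
desc⇒star (d-left d)  = gmap left (Sum.map cl-left cr-left) (desc⇒star d)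
desc⇒star (d-right d) = gmap right (Sum.map cl-right cr-right) (desc⇒star d)

fork-swap : Fork w p q → Fork w q p
fork-swap (inj₁ (x , y)) = inj₂ (y , x)
fork-swap (inj₂ (x , y)) = inj₁ (y , x)

fork⇒strictˡ : Fork w p q → Strict w p
fork⇒strictˡ (inj₁ (x , _)) = inj₁ x
fork⇒strictˡ (inj₂ (x , _)) = inj₂ x

fork⇒strictʳ : Fork w p q → Strict w q
fork⇒strictʳ (inj₁ (_ , y)) = inj₂ y
fork⇒strictʳ (inj₂ (_ , y)) = inj₁ y

fork⇒descˡ : Fork w p q → Desc w p
fork⇒descˡ (inj₁ (x , _)) = inL⇒desc x
fork⇒descˡ (inj₂ (x , _)) = inR⇒desc x

fork⇒descʳ : Fork w p q → Desc w q
fork⇒descʳ (inj₁ (_ , y)) = inR⇒desc y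
fork⇒descʳ (inj₂ (_ , y)) = inL⇒desc y

fork⇒node : Fork w p q → IsNode (subtreeAt t w)
fork⇒node (inj₁ (x , _)) = inL⇒node x
fork⇒node (inj₂ (_ , y)) = inL⇒node y

fork-desc-trans : {p′ q′ : Pos t} → Fork w p q → Desc p p′ → Desc q q′ → Fork w p′ q′
fork-desc-trans (inj₁ (x , y)) d e = inj₁ (inL-desc-trans x d , inR-desc-trans y e)
fork-desc-trans (inj₂ (x , y)) d e = inj₂ (inR-desc-trans x d , inL-desc-trans y e)

fork-left : Fork w p q → Fork {t = node l r} (left w) (left p) (left q)
fork-left (inj₁ (x , y)) = inj₁ (inL-left x , inR-left y)
fork-left (inj₂ (x , y)) = inj₂ (inR-left x , inL-left y)

fork-right : Fork w p q → Fork {t = node l r} (right w) (right p) (right q)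
fork-right (inj₁ (x , y)) = inj₁ (inL-right x , inR-right y)
fork-right (inj₂ (x , y)) = inj₂ (inR-right x , inL-right y)

meet-swap : Meet t a b w → Meet t b a w
meet-swap (p , q , ep , eq , f) = q , p , eq , ep , fork-swap f

meet-left : Meet l a b w → Meet (node l r) a b (left w)
meet-left (p , q , ep , eq , f) = left p , left q , ep , eq , fork-left f

meet-right : Meet r a b w → Meet (node l r) a b (right w)
meet-right (p , q , ep , eq , f) = right p , right q , ep , eq , fork-right f

-- Positions in a forest

data FDesc (F : Forest n) : FPos F → FPos F → Set where
  mk : ∀ {k} {p q : Pos (lookup F k)} → Desc p q → FDesc F (k , p) (k , q)

FStrict : (F : Forest n) → FPos F → FPos F → Set
FStrict F x y = FInL F x y ⊎ FInR F x y

FFork : (F : Forest n) → FPos F → FPos F → FPos F → Set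
FFork F v y z = (FInL F v y × FInR F v z) ⊎ (FInR F v y × FInL F v z)

-- IsVertex T a b is FMeet [ T ] a b by definition.
FMeet : (F : Forest n) → Fin n → Fin n → FPos F → Set
FMeet F a b v = Σ (FPos F) λ y → Σ (FPos F) λ z →
  FSub F y ≡ leaf a × FSub F z ≡ leaf b × FFork F v y z

module _ {n : ℕ} {F : Forest n} where

  fdesc-refl : (x : FPos F) → FDesc F x x
  fdesc-refl (_ , p) = mk (desc-refl p)

  fdesc-trans : {x y z : FPos F} → FDesc F x y → FDesc F y z → FDesc F x z
  fdesc-trans (mk d) (mk e) = mk (desc-trans d e)

  fdesc-linear : {x y z : FPos F} → FDesc F x z → FDesc F y z → FDesc F x y ⊎ FDesc F y x
  fdesc-linear (mk d) (mk e) = Sum.map mk mk (desc-linear d e)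

  fdesc⇒≡⊎strict : {x y : FPos F} → FDesc F x y → x ≡ y ⊎ FStrict F x y
  fdesc⇒≡⊎strict (mk d) = Sum.map (cong (_ ,_)) (Sum.map mk mk) (desc⇒≡⊎strict d)

  strict⇒fstrict : ∀ {k} {p q : Pos (lookup F k)} → Strict p q → FStrict F (k , p) (k , q)
  strict⇒fstrict = Sum.map mk mk

  fstrict⇒¬fdesc : {x y : FPos F} → FStrict F x y → FDesc F y x → ⊥
  fstrict⇒¬fdesc (inj₁ (mk s)) (mk d) = strict⇒¬desc (inj₁ s) d
  fstrict⇒¬fdesc (inj₂ (mk s)) (mk d) = strict⇒¬desc (inj₂ s) d

  finL⇒¬finR : {x y : FPos F} → FInL F x y → FInR F x y → ⊥
  finL⇒¬finR (mk s) (mk s′) = inL⇒¬inR s s′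

  finL-desc-trans : {x y z : FPos F} → FInL F x y → FDesc F y z → FInL F x z
  finL-desc-trans (mk s) (mk d) = mk (inL-desc-trans s d)

  finR-desc-trans : {x y z : FPos F} → FInR F x y → FDesc F y z → FInR F x z
  finR-desc-trans (mk s) (mk d) = mk (inR-desc-trans s d)

  fchildL⇒node : {x y : FPos F} → FChildL F x y → IsNode (FSub F x)
  fchildL⇒node (mk h) = childL⇒node h

  fork⇒ffork : ∀ {k} {w p q : Pos (lookup F k)} → Fork w p q → FFork F (k , w) (k , p) (k , q)
  fork⇒ffork (inj₁ (x , y)) = inj₁ (mk x , mk y)
  fork⇒ffork (inj₂ (x , y)) = inj₂ (mk x , mk y)

  meet⇒fmeet : ∀ {k} {w : Pos (lookup F k)} → Meet (lookup F k) a b w → FMeet F a b (k , w)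
  meet⇒fmeet (p , q , ep , eq , f) = (_ , p) , (_ , q) , ep , eq , fork⇒ffork f

  ffork-swap : {v y z : FPos F} → FFork F v y z → FFork F v z y
  ffork-swap (inj₁ (s , s′)) = inj₂ (s′ , s)
  ffork-swap (inj₂ (s , s′)) = inj₁ (s′ , s)

  ffork⇒descˡ : {v y z : FPos F} → FFork F v y z → FDesc F v y
  ffork⇒descˡ (inj₁ (mk s , _)) = mk (inL⇒desc s)
  ffork⇒descˡ (inj₂ (mk s , _)) = mk (inR⇒desc s)

  ffork⇒descʳ : {v y z : FPos F} → FFork F v y z → FDesc F v z
  ffork⇒descʳ (inj₁ (_ , mk s)) = mk (inR⇒desc s)
  ffork⇒descʳ (inj₂ (_ , mk s)) = mk (inL⇒desc s)

  ffork⇒node : {v y z : FPos F} → FFork F v y z → IsNode (FSub F v)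
  ffork⇒node (inj₁ (mk s , _)) = inL⇒node s
  ffork⇒node (inj₂ (_ , mk s)) = inL⇒node s

  ffork-desc-trans : {v y z y′ z′ : FPos F} →
    FFork F v y z → FDesc F y y′ → FDesc F z z′ → FFork F v y′ z′
  ffork-desc-trans (inj₁ (s , s′)) d e = inj₁ (finL-desc-trans s d , finR-desc-trans s′ e)
  ffork-desc-trans (inj₂ (s , s′)) d e = inj₂ (finR-desc-trans s d , finL-desc-trans s′ e)

  ffork-lowest : {v v′ y z : FPos F} →
    FFork F v y z → FDesc F v v′ → FDesc F v′ y → FDesc F v′ z → v ≡ v′
  ffork-lowest f d dy dz with fdesc⇒≡⊎strict d
  ffork-lowest _                _ _  _  | inj₁ v≡v′       = v≡v′
  ffork-lowest (inj₁ (_ , zR))  _ _  dz | inj₂ (inj₁ sL) = ⊥-elim (finL⇒¬finR (finL-desc-trans sL dz) zR)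
  ffork-lowest (inj₂ (yR , _))  _ dy _  | inj₂ (inj₁ sL) = ⊥-elim (finL⇒¬finR (finL-desc-trans sL dy) yR)
  ffork-lowest (inj₁ (yL , _))  _ dy _  | inj₂ (inj₂ sR) = ⊥-elim (finL⇒¬finR yL (finR-desc-trans sR dy))
  ffork-lowest (inj₂ (_ , zL))  _ _  dz | inj₂ (inj₂ sR) = ⊥-elim (finL⇒¬finR zL (finR-desc-trans sR dz))

  ffork-unique : {v v′ y z : FPos F} → FFork F v y z → FFork F v′ y z → v ≡ v′
  ffork-unique f f′ with fdesc-linear (ffork⇒descˡ f) (ffork⇒descˡ f′)
  ... | inj₁ d = ffork-lowest f d (ffork⇒descˡ f′) (ffork⇒descʳ f′)
  ... | inj₂ d = sym (ffork-lowest f′ d (ffork⇒descˡ f) (ffork⇒descʳ f))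

  ffork-between : {v y z y′ z′ : FPos F} → FFork F v y z →
    FStrict F v y′ → FDesc F y′ y → FStrict F v z′ → FDesc F z′ z → FFork F v y′ z′
  ffork-between (inj₁ (_ , zR)) (inj₁ sy) _  (inj₁ sz) dz = ⊥-elim (finL⇒¬finR (finL-desc-trans sz dz) zR)
  ffork-between (inj₁ _)        (inj₁ sy) _  (inj₂ sz) _  = inj₁ (sy , sz)
  ffork-between (inj₁ (yL , _)) (inj₂ sy) dy _         _  = ⊥-elim (finL⇒¬finR yL (finR-desc-trans sy dy))
  ffork-between (inj₂ (yR , _)) (inj₁ sy) dy _         _  = ⊥-elim (finL⇒¬finR (finL-desc-trans sy dy) yR)
  ffork-between (inj₂ _)        (inj₂ sy) _  (inj₁ sz) _  = inj₂ (sy , sz)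
  ffork-between (inj₂ (_ , zL)) (inj₂ sy) _  (inj₂ sz) dz = ⊥-elim (finL⇒¬finR zL (finR-desc-trans sz dz))

-- Maps between forests

PreservesLeaves : (F G : Forest n) → (FPos F → FPos G) → Set
PreservesLeaves F G α = ∀ x a → FSub F x ≡ leaf a → FSub G (α x) ≡ leaf a

PreservesEdges : (F G : Forest n) → (FPos F → FPos G) → Set
PreservesEdges F G α = ∀ x cl cr → FChildL F x cl → FChildR F x cr → FFork G (α x) (α cl) (α cr)

module _ {n : ℕ} {F G : Forest n} {α : FPos F → FPos G} (edges : PreservesEdges F G α) where

  preserves-child : ∀ {k} {p c : Pos (lookup F k)} → Child p c → FDesc G (α (k , p)) (α (k , c))
  preserves-child (inj₁ h) = ffork⇒descˡ (edges _ _ _ (mk h) (mk (proj₂ (childL⇒childR h))))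
  preserves-child (inj₂ h) = ffork⇒descʳ (edges _ _ _ (mk (proj₂ (childR⇒childL h))) (mk h))

  preserves-desc : {x y : FPos F} → FDesc F x y → FDesc G (α x) (α y)
  preserves-desc (mk {k} d) = along (desc⇒star d)
    where
    along : {p q : Pos (lookup F k)} → Star Child p q → FDesc G (α (k , p)) (α (k , q))
    along ε       = fdesc-refl _
    along (h ◅ s) = fdesc-trans (preserves-child h) (along s)

  preserves-fork : {x y z : FPos F} → FFork F x y z → FFork G (α x) (α y) (α z)
  preserves-fork (inj₁ (mk yL , mk zR)) with inL⇒childL yL | inR⇒childR zR
  ... | _ , hl , dl | _ , hr , dr =
    ffork-desc-trans (edges _ _ _ (mk hl) (mk hr)) (preserves-desc (mk dl)) (preserves-desc (mk dr))
  preserves-fork (inj₂ (mk yR , mk zL)) with inL⇒childL zL | inR⇒childR yR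
  ... | _ , hl , dl | _ , hr , dr =
    ffork-swap (ffork-desc-trans (edges _ _ _ (mk hl) (mk hr)) (preserves-desc (mk dl)) (preserves-desc (mk dr)))

  preserves-meet : PreservesLeaves F G α → {a b : Fin n} {x : FPos F} → FMeet F a b x → FMeet G a b (α x)
  preserves-meet onLeaves (y , z , ey , ez , f) = α y , α z , onLeaves y _ ey , onLeaves z _ ez , preserves-fork f

  reflects-strict : {x y z : FPos F} → FDesc F x z → FDesc F y z → FStrict G (α x) (α y) → FStrict F x y
  reflects-strict dx dy s with fdesc-linear dx dy
  ... | inj₂ y⊑x = ⊥-elim (fstrict⇒¬fdesc s (preserves-desc y⊑x))
  ... | inj₁ x⊑y with fdesc⇒≡⊎strict x⊑y
  ...   | inj₂ x<y = x<y
  ...   | inj₁ refl = ⊥-elim (fstrict⇒¬fdesc s (fdesc-refl _))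

≤F-preserves-meet : ((α , _) : F ≤F G) {x : FPos F} → FMeet F a b x → FMeet G a b (α x)
≤F-preserves-meet (_ , M) = preserves-meet onEdges onLeaves
  where open IsMorphism M

≤F-trans : F ≤F G → G ≤F H → F ≤F H
≤F-trans (α , Mα) (β , Mβ) = (λ x → β (α x)) , record
  { onLeaves = λ x a e → Mβ.onLeaves (α x) a (Mα.onLeaves x a e)
  ; onInner  = λ x nx → Mβ.onInner (α x) (Mα.onInner x nx)
  ; innerInj = λ x y nx ny e →
      Mα.innerInj x y nx ny (Mβ.innerInj (α x) (α y) (Mα.onInner x nx) (Mα.onInner y ny) e)
  ; onEdges  = λ x cl cr hl hr → preserves-fork Mβ.onEdges (Mα.onEdges x cl cr hl hr)
  }
  where
  module Mα = IsMorphism Mα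
  module Mβ = IsMorphism Mβ

-- Leaf labels

labels : Forest n → List (Fin n)
labels = concatMap leaves

labels-++ : (F G : Forest n) → labels (F ++ G) ≡ labels F ++ labels G
labels-++ = concatMap-++ leaves

module _ {A : Set} where

  unique-++⁻ˡ : (xs : List A) {ys : List A} → Unique (xs ++ ys) → Unique xs
  unique-++⁻ˡ []       _         = []
  unique-++⁻ˡ (x ∷ xs) (x∉ ∷ u) = Allₚ.++⁻ˡ xs x∉ ∷ unique-++⁻ˡ xs u

  unique-++⁻ʳ : (xs : List A) {ys : List A} → Unique (xs ++ ys) → Unique ys
  unique-++⁻ʳ []       u       = u
  unique-++⁻ʳ (x ∷ xs) (_ ∷ u) = unique-++⁻ʳ xs u

  unique-++⇒disjoint : (xs : List A) {ys : List A} {v : A} → Unique (xs ++ ys) → v ∈ xs → v ∈ ys → ⊥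
  unique-++⇒disjoint (x ∷ xs) (x∉ ∷ _) (Any.here refl) v∈ = All.lookup (Allₚ.++⁻ʳ xs x∉) v∈ refl
  unique-++⇒disjoint (x ∷ xs) (_ ∷ u)  (Any.there v∈) v∈′ = unique-++⇒disjoint xs u v∈ v∈′

leaf⇒∈leaves : (p : Pos t) → subtreeAt t p ≡ leaf a → a ∈ leaves t
leaf⇒∈leaves {t = leaf _}   here      refl = Any.here refl
leaf⇒∈leaves {t = node _ _} here      ()
leaf⇒∈leaves {t = node _ _} (left p)  e    = ∈-++⁺ˡ (leaf⇒∈leaves p e)
leaf⇒∈leaves {t = node l _} (right p) e    = ∈-++⁺ʳ (leaves l) (leaf⇒∈leaves p e)

∈leaves⇒leaf : a ∈ leaves t → Σ (Pos t) λ p → subtreeAt t p ≡ leaf a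
∈leaves⇒leaf {t = leaf _} (Any.here refl) = here , refl
∈leaves⇒leaf {t = node l _} a∈ with ∈-++⁻ (leaves l) a∈
... | inj₁ a∈l = Product.map left id (∈leaves⇒leaf a∈l)
... | inj₂ a∈r = Product.map right id (∈leaves⇒leaf a∈r)

∈subtree⇒leaf : (q : Pos t) → a ∈ leaves (subtreeAt t q) →
  Σ (Pos t) λ p → Desc q p × subtreeAt t p ≡ leaf a
∈subtree⇒leaf here a∈ = Product.map id (d-here ,_) (∈leaves⇒leaf a∈)
∈subtree⇒leaf {t = node _ _} (left q)  a∈ = Product.map left (Product.map₁ d-left) (∈subtree⇒leaf q a∈)
∈subtree⇒leaf {t = node _ _} (right q) a∈ = Product.map right (Product.map₁ d-right) (∈subtree⇒leaf q a∈)

children-meet : ChildL w p → ChildR w q →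
  a ∈ leaves (subtreeAt t p) → b ∈ leaves (subtreeAt t q) → Meet t a b w
children-meet {p = p} {q = q} hl hr a∈ b∈ with ∈subtree⇒leaf p a∈ | ∈subtree⇒leaf q b∈
... | p′ , dp , ep | q′ , dq , eq = p′ , q′ , ep , eq , inj₁ (childL-desc⇒inL hl dp , childR-desc⇒inR hr dq)

leaf-unique : Unique (leaves t) → (p q : Pos t) → subtreeAt t p ≡ leaf a → subtreeAt t q ≡ leaf a → p ≡ q
leaf-unique {t = leaf _}   _ here      here      _  _  = refl
leaf-unique {t = node _ _} _ here      _         () _
leaf-unique {t = node _ _} _ (left _)  here      _  ()
leaf-unique {t = node _ _} _ (right _) here      _  ()
leaf-unique {t = node l _} u (left p)  (left q)  ep eq = cong left (leaf-unique (unique-++⁻ˡ (leaves l) u) p q ep eq)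
leaf-unique {t = node l _} u (right p) (right q) ep eq = cong right (leaf-unique (unique-++⁻ʳ (leaves l) u) p q ep eq)
leaf-unique {t = node l _} u (left p)  (right q) ep eq =
  ⊥-elim (unique-++⇒disjoint (leaves l) u (leaf⇒∈leaves p ep) (leaf⇒∈leaves q eq))
leaf-unique {t = node l _} u (right p) (left q)  ep eq =
  ⊥-elim (unique-++⇒disjoint (leaves l) u (leaf⇒∈leaves q eq) (leaf⇒∈leaves p ep))

fleaf⇒∈labels : (x : FPos F) → FSub F x ≡ leaf a → a ∈ labels F
fleaf⇒∈labels {F = t ∷ _} (zero , p)  e = ∈-++⁺ˡ (leaf⇒∈leaves p e)
fleaf⇒∈labels {F = t ∷ F} (suc k , p) e = ∈-++⁺ʳ (leaves t) (fleaf⇒∈labels {F = F} (k , p) e)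

∈labels⇒fleaf : a ∈ labels F → Σ (FPos F) λ x → FSub F x ≡ leaf a
∈labels⇒fleaf {F = t ∷ F} a∈ with ∈-++⁻ (leaves t) a∈
... | inj₁ a∈t = Product.map (zero ,_) id (∈leaves⇒leaf a∈t)
... | inj₂ a∈F = let ((k , p) , e) = ∈labels⇒fleaf {F = F} a∈F in (suc k , p) , e

fleaf-unique : Unique (labels F) → (x y : FPos F) → FSub F x ≡ leaf a → FSub F y ≡ leaf a → x ≡ y
fleaf-unique {F = t ∷ _} u (zero , p) (zero , q) ep eq =
  cong (zero ,_) (leaf-unique (unique-++⁻ˡ (leaves t) u) p q ep eq)
fleaf-unique {F = t ∷ F} u (zero , p) (suc k , q) ep eq =
  ⊥-elim (unique-++⇒disjoint (leaves t) u (leaf⇒∈leaves p ep) (fleaf⇒∈labels {F = F} (k , q) eq))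
fleaf-unique {F = t ∷ F} u (suc k , p) (zero , q) ep eq =
  ⊥-elim (unique-++⇒disjoint (leaves t) u (leaf⇒∈leaves q eq) (fleaf⇒∈labels {F = F} (k , p) ep))
fleaf-unique {F = t ∷ F} u (suc k , p) (suc k′ , q) ep eq
  with fleaf-unique {F = F} (unique-++⁻ʳ (leaves t) u) (k , p) (k′ , q) ep eq
... | refl = refl

fmeet-unique : Unique (labels F) → {x x′ : FPos F} → FMeet F a b x → FMeet F a b x′ → x ≡ x′
fmeet-unique {F = F} u (y , z , ey , ez , f) (y′ , z′ , ey′ , ez′ , f′)
  with fleaf-unique {F = F} u y y′ ey ey′ | fleaf-unique {F = F} u z z′ ez ez′
... | refl | refl = ffork-unique f f′

-- Each inner vertex must go to the unique fork of the images of its two children.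
≤F-unique : Unique (labels G) → (α β : F ≤F G) → ∀ x → proj₁ α x ≡ proj₁ β x
≤F-unique {G = G} {F = F} u (α , Mα) (β , Mβ) (k , p₀) = agree (subtreeAt (lookup F k) p₀) p₀ refl
  where
  module Mα = IsMorphism Mα
  module Mβ = IsMorphism Mβ
  agree : (s : Tree _) (p : Pos (lookup F k)) → subtreeAt (lookup F k) p ≡ s → α (k , p) ≡ β (k , p)
  agree (leaf a) p e = fleaf-unique {F = G} u _ _ (Mα.onLeaves (k , p) a e) (Mβ.onLeaves (k , p) a e)
  agree (node l r) p e with childL-at p e | childR-at p e
  ... | cl , hl , el | cr , hr , er =
    ffork-unique (Mα.onEdges _ _ _ (mk hl) (mk hr))
      (subst₂ (FFork G (β (k , p))) (sym (agree l cl el)) (sym (agree r cr er)) (Mβ.onEdges _ _ _ (mk hl) (mk hr)))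

module _ {n : ℕ} (F : Forest n) (isF : IsForestOn F) where

  forestOn⇒unique : Unique (labels F)
  forestOn⇒unique = PermutationSetoid.Unique-resp-↭ (setoid (Fin n)) (↭⇒↭ₛ (↭-sym isF)) (allFin⁺ n)

  leafOf : Fin n → FPos F
  leafOf a = proj₁ (∈labels⇒fleaf {F = F} (∈-resp-↭ (↭-sym isF) (∈-allFin a)))

  leafOf-leaf : (a : Fin n) → FSub F (leafOf a) ≡ leaf a
  leafOf-leaf a = proj₂ (∈labels⇒fleaf {F = F} (∈-resp-↭ (↭-sym isF) (∈-allFin a)))

  leafOf-unique : {a : Fin n} (x : FPos F) → FSub F x ≡ leaf a → x ≡ leafOf a
  leafOf-unique {a} x e = fleaf-unique {F = F} forestOn⇒unique x (leafOf a) e (leafOf-leaf a)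

-- 0̂ and the atoms

map-leaf⇒leaf : (xs : List (Fin n)) (k : Fin (length (map leaf xs))) (p : Pos (lookup (map leaf xs) k)) →
  Σ (Fin n) λ a → subtreeAt (lookup (map leaf xs) k) p ≡ leaf a
map-leaf⇒leaf (x ∷ _)  zero    here = x , refl
map-leaf⇒leaf (_ ∷ xs) (suc k) p    = map-leaf⇒leaf xs k p

zeroF-least : {n : ℕ} {F : Forest n} → IsForestOn F → zeroF ≤F F
zeroF-least {n = n} {F = F} isF = α , record
  { onLeaves = on-leaves
  ; onInner  = λ x nx → ⊥-elim (no-inner x nx)
  ; innerInj = λ x _ nx _ _ → ⊥-elim (no-inner x nx)
  ; onEdges  = λ x _ _ h _ → ⊥-elim (no-inner x (fchildL⇒node h))
  }
  where
  α : FPos zeroF → FPos F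
  α (k , p) = leafOf F isF (proj₁ (map-leaf⇒leaf (allFin n) k p))
  no-inner : (x : FPos (zeroF {n})) → IsNode (FSub zeroF x) → ⊥
  no-inner (k , p) nx = isNode⇒≢leaf nx (proj₂ (map-leaf⇒leaf (allFin n) k p))
  on-leaves : PreservesLeaves zeroF F α
  on-leaves (k , p) a e with map-leaf⇒leaf (allFin n) k p
  ... | c , e′ with trans (sym e′) e
  ...   | refl = leafOf-leaf F isF c

atomRoot : FPos (atom a b)
atomRoot = zero , here

atom-root-meet : ((ψ , _) : atom a b ≤F F) → FMeet F a b (ψ atomRoot)
atom-root-meet (ψ , M) =
  ψ (zero , left here) , ψ (zero , right here) ,
  onLeaves (zero , left here) _ refl , onLeaves (zero , right here) _ refl ,
  onEdges atomRoot (zero , left here) (zero , right here) (mk cl-here) (mk cr-here)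
  where open IsMorphism M

atom≤F : {n : ℕ} {F : Forest n} {a b : Fin n} → IsForestOn F → {x : FPos F} → FMeet F a b x → atom a b ≤F F
atom≤F {n = n} {F = F} {a = a} {b = b} isF {x} (y , z , ey , ez , f) = α , record
  { onLeaves = on-leaves
  ; onInner  = λ v nv → subst (λ v → IsNode (FSub F (α v))) (sym (only-root v nv)) (ffork⇒node f)
  ; innerInj = λ v v′ nv nv′ _ → trans (only-root v nv) (sym (only-root v′ nv′))
  ; onEdges  = on-edges
  }
  where
  -- the labels of the one-leaf trees of atom a b, exactly as in its definition
  others : List (Fin n)
  others = filter (λ m → ¬? (m ≟ a) ×-dec ¬? (m ≟ b)) (allFin n)
  α : FPos (atom a b) → FPos F
  α (zero , here)       = x
  α (zero , left here)  = y
  α (zero , right here) = z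
  α (suc k , p)         = leafOf F isF (proj₁ (map-leaf⇒leaf others k p))
  on-leaves : PreservesLeaves (atom a b) F α
  on-leaves (zero , here)       _ ()
  on-leaves (zero , left here)  _ refl = ey
  on-leaves (zero , right here) _ refl = ez
  on-leaves (suc k , p) c e with map-leaf⇒leaf others k p
  ... | c′ , e′ with trans (sym e′) e
  ...   | refl = leafOf-leaf F isF c′
  only-root : (v : FPos (atom a b)) → IsNode (FSub (atom a b) v) → v ≡ atomRoot
  only-root (zero , here)       _  = refl
  only-root (zero , left here)  ()
  only-root (zero , right here) ()
  only-root (suc k , p) nv = ⊥-elim (isNode⇒≢leaf nv (proj₂ (map-leaf⇒leaf others k p)))
  on-edges : PreservesEdges (atom a b) F α
  on-edges (zero , here) (zero , left here) (zero , right here) (mk cl-here) (mk cr-here) = f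
  on-edges (suc k , p) _ _ (mk h) _ = ⊥-elim (isNode⇒≢leaf (childL⇒node h) (proj₂ (map-leaf⇒leaf others k p)))

-- Grafting

split-at-label : a ∈ labels F →
  Σ (Tree n) λ t → Σ (Forest n) λ ys → Σ (Forest n) λ zs → F ≡ ys ++ t ∷ zs × a ∈ leaves t
split-at-label {F = F} a∈ with ∈-concat⁻′ (map leaves F) a∈
... | _ , a∈xs , xs∈ with ∈-map⁻ leaves xs∈
...   | t , t∈F , refl with ∈-∃++ t∈F
...     | ys , zs , F≡ = t , ys , zs , F≡ , a∈xs

any-hasMeet⇒fmeet : Any (HasMeet a b) F → Σ (FPos F) (FMeet F a b)
any-hasMeet⇒fmeet {F = F} h =
  (Any.index h , proj₁ (Anyₚ.lookup-result h)) , meet⇒fmeet {F = F} (proj₂ (Anyₚ.lookup-result h))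

graft-labels : (ysl : Forest n) {tl : Tree n} {zsl : Forest n} (ysr : Forest n) {tr : Tree n} {zsr : Forest n}
  {L R : List (Fin n)} → labels (ysl ++ tl ∷ zsl) ↭ L → labels (ysr ++ tr ∷ zsr) ↭ R →
  labels (node tl tr ∷ (ysl ++ zsl) ++ (ysr ++ zsr)) ↭ L ++ R
graft-labels {n = n} ysl {tl} {zsl} ysr {tr} {zsr} {L} {R} σl σr = begin
  (leaves tl ++ leaves tr) ++ labels ((ysl ++ zsl) ++ (ysr ++ zsr))
    ≡⟨ cong ((leaves tl ++ leaves tr) ++_) split ⟩
  (leaves tl ++ leaves tr) ++ ((labels ysl ++ labels zsl) ++ (labels ysr ++ labels zsr))
    ↭⟨ shuffle (leaves tl) (leaves tr) (labels ysl) (labels zsl) (labels ysr) (labels zsr) ⟩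
  (labels ysl ++ (leaves tl ++ labels zsl)) ++ (labels ysr ++ (leaves tr ++ labels zsr))
    ≡⟨ sym (cong₂ _++_ (labels-++ ysl (tl ∷ zsl)) (labels-++ ysr (tr ∷ zsr))) ⟩
  labels (ysl ++ tl ∷ zsl) ++ labels (ysr ++ tr ∷ zsr)
    ↭⟨ ++⁺ σl σr ⟩
  L ++ R ∎
  where
  open PermutationReasoning
  open CommutativeMonoidSolver (++-commutativeMonoid {A = Fin n})
  split : labels ((ysl ++ zsl) ++ (ysr ++ zsr)) ≡ (labels ysl ++ labels zsl) ++ (labels ysr ++ labels zsr)
  split = trans (labels-++ (ysl ++ zsl) (ysr ++ zsr)) (cong₂ _++_ (labels-++ ysl zsl) (labels-++ ysr zsr))
  shuffle : (a b y z y′ z′ : List (Fin n)) →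
    (a ++ b) ++ ((y ++ z) ++ (y′ ++ z′)) ↭ (y ++ (a ++ z)) ++ (y′ ++ (b ++ z′))
  shuffle = solve 6 (λ a b y z y′ z′ →
    (a ⊕ b) ⊕ ((y ⊕ z) ⊕ (y′ ⊕ z′)) ⊜ (y ⊕ (a ⊕ z)) ⊕ (y′ ⊕ (b ⊕ z′))) ↭-refl

graft-anyˡ : (ysl : Forest n) {tl : Tree n} {zsl : Forest n} {tr : Tree n} {W : Forest n} →
  Any (HasMeet a b) (ysl ++ tl ∷ zsl) → Any (HasMeet a b) (node tl tr ∷ (ysl ++ zsl) ++ W)
graft-anyˡ ysl h with Anyₚ.++⁻ ysl h
... | inj₁ h′                    = Any.there (Anyₚ.++⁺ˡ (Anyₚ.++⁺ˡ h′))
... | inj₂ (Any.here (w , m))   = Any.here (left w , meet-left m)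
... | inj₂ (Any.there h′)        = Any.there (Anyₚ.++⁺ˡ (Anyₚ.++⁺ʳ ysl h′))

graft-anyʳ : (ysl : Forest n) {tl : Tree n} {zsl : Forest n} (ysr : Forest n) {tr : Tree n} {zsr : Forest n} →
  Any (HasMeet a b) (ysr ++ tr ∷ zsr) → Any (HasMeet a b) (node tl tr ∷ (ysl ++ zsl) ++ (ysr ++ zsr))
graft-anyʳ ysl {zsl = zsl} ysr h with Anyₚ.++⁻ ysr h
... | inj₁ h′                    = Any.there (Anyₚ.++⁺ʳ (ysl ++ zsl) (Anyₚ.++⁺ˡ h′))
... | inj₂ (Any.here (w , m))   = Any.here (right w , meet-right m)
... | inj₂ (Any.there h′)        = Any.there (Anyₚ.++⁺ʳ (ysl ++ zsl) (Anyₚ.++⁺ʳ ysr h′))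

-- The join of the atoms

module JoinOfAtoms {n k : ℕ} (T : Tree n) (isT : IsTreeOn T) (i j : Fin k → Fin n)
            (i≢j : ∀ s → i s ≢ j s)
            (distinct : ∀ r s x → IsVertex T (i r) (j r) x → IsVertex T (i s) (j s) x → r ≡ s) where

  T-forestOn : IsForestOn [ T ]
  T-forestOn = ↭-trans (↭-reflexive (++-identityʳ (leaves T))) isT

  T-unique : Unique (labels [ T ])
  T-unique = forestOn⇒unique [ T ] T-forestOn

  Straddles : Fin k → Tree n → Tree n → Set
  Straddles s l r = (i s ∈ leaves l × j s ∈ leaves r) ⊎ (j s ∈ leaves l × i s ∈ leaves r)

  straddles? : ∀ s l r → Dec (Straddles s l r)
  straddles? s l r =
    (Any.any? (i s ≟_) (leaves l) ×-dec Any.any? (j s ≟_) (leaves r)) ⊎-dec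
    (Any.any? (j s ≟_) (leaves l) ×-dec Any.any? (i s ≟_) (leaves r))

  straddle⇒meet : ∀ {s l r} → Straddles s l r → Meet (node l r) (i s) (j s) here
  straddle⇒meet (inj₁ (il , jr)) = children-meet cl-here cr-here il jr
  straddle⇒meet (inj₂ (jl , ir)) = meet-swap (children-meet cl-here cr-here jl ir)

  straddle⇒vertex : ∀ {s l r} {p pl pr : Pos T} → ChildL p pl → ChildR p pr →
    subtreeAt T pl ≡ l → subtreeAt T pr ≡ r → Straddles s l r → IsVertex T (i s) (j s) (zero , p)
  straddle⇒vertex hl hr refl refl (inj₁ (il , jr)) = meet⇒fmeet {F = [ T ]} (children-meet hl hr il jr)
  straddle⇒vertex hl hr refl refl (inj₂ (jl , ir)) = meet⇒fmeet {F = [ T ]} (meet-swap (children-meet hl hr jl ir))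

  data Placed : Tree n → Pos T → Set where
    placed-leaf : ∀ {a w} → subtreeAt T w ≡ leaf a → Placed (leaf a) w
    placed-node : ∀ {l r w wl wr} (s : Fin k) → Straddles s l r → Fork w wl wr →
                  Placed l wl → Placed r wr → Placed (node l r) w

  PlacedBelow : Pos T → Tree n → Set
  PlacedBelow p t = Σ (Pos T) λ w → Desc p w × Placed t w

  placedBelow-lift : ∀ {p p′ t} → Desc p p′ → PlacedBelow p′ t → PlacedBelow p t
  placedBelow-lift d (w , d′ , g) = w , desc-trans d d′ , g

  -- Assembly p t F : F is the part of J₀ built from the subtree t of T at p.
  record Assembly (p : Pos T) (t : Tree n) (F : Forest n) : Set where
    field
      labels↭ : labels F ↭ leaves t
      placed  : All (PlacedBelow p) F
      meets   : ∀ s → i s ∈ leaves t → j s ∈ leaves t → Any (HasMeet (i s) (j s)) F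

  open Assembly

  juxtapose : ∀ {p pl pr l r Fl Fr} → ChildL p pl → ChildR p pr →
    Assembly pl l Fl → Assembly pr r Fr → (∀ s → ¬ Straddles s l r) → Assembly p (node l r) (Fl ++ Fr)
  juxtapose {l = l} {r} {Fl} {Fr} hl hr Al Ar ¬st = record
    { labels↭ = ↭-trans (↭-reflexive (labels-++ Fl Fr)) (++⁺ (labels↭ Al) (labels↭ Ar))
    ; placed  = Allₚ.++⁺ (All.map (placedBelow-lift (childL⇒desc hl)) (placed Al))
                         (All.map (placedBelow-lift (childR⇒desc hr)) (placed Ar))
    ; meets   = meets-juxtaposed
    }
    where
    meets-juxtaposed : ∀ s → i s ∈ leaves l ++ leaves r → j s ∈ leaves l ++ leaves r →
                       Any (HasMeet (i s) (j s)) (Fl ++ Fr)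
    meets-juxtaposed s i∈ j∈ with ∈-++⁻ (leaves l) i∈ | ∈-++⁻ (leaves l) j∈
    ... | inj₁ il | inj₁ jl = Anyₚ.++⁺ˡ (meets Al s il jl)
    ... | inj₂ ir | inj₂ jr = Anyₚ.++⁺ʳ Fl (meets Ar s ir jr)
    ... | inj₁ il | inj₂ jr = ⊥-elim (¬st s (inj₁ (il , jr)))
    ... | inj₂ ir | inj₁ jl = ⊥-elim (¬st s (inj₂ (jl , ir)))

  graft-placed : ∀ {p pl pr s} ysl ysr {tl zsl tr zsr} → ChildL p pl → ChildR p pr → Straddles s tl tr →
    All (PlacedBelow pl) (ysl ++ tl ∷ zsl) → All (PlacedBelow pr) (ysr ++ tr ∷ zsr) →
    All (PlacedBelow p) (node tl tr ∷ (ysl ++ zsl) ++ (ysr ++ zsr))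
  graft-placed {p} {s = s} ysl ysr hl hr st Al Ar with Allₚ.++⁻ ysl Al | Allₚ.++⁻ ysr Ar
  ... | Ayl , (_ , dl , gl) ∷ Azl | Ayr , (_ , dr , gr) ∷ Azr =
    (p , desc-refl p , placed-node s st (inj₁ (childL-desc⇒inL hl dl , childR-desc⇒inR hr dr)) gl gr)
    ∷ Allₚ.++⁺ (All.map (placedBelow-lift (childL⇒desc hl)) (Allₚ.++⁺ Ayl Azl))
               (All.map (placedBelow-lift (childR⇒desc hr)) (Allₚ.++⁺ Ayr Azr))

  graft : ∀ {p pl pr l r s} ysl ysr {tl zsl tr zsr} → ChildL p pl → ChildR p pr →
    Assembly pl l (ysl ++ tl ∷ zsl) → Assembly pr r (ysr ++ tr ∷ zsr) →
    Straddles s tl tr → (∀ s′ → Straddles s′ l r → s′ ≡ s) →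
    Assembly p (node l r) (node tl tr ∷ (ysl ++ zsl) ++ (ysr ++ zsr))
  graft {l = l} {r} {s} ysl ysr {tl} {zsl} {tr} {zsr} hl hr Al Ar st only-s = record
    { labels↭ = graft-labels ysl ysr (labels↭ Al) (labels↭ Ar)
    ; placed  = graft-placed ysl ysr hl hr st (placed Al) (placed Ar)
    ; meets   = meets-grafted
    }
    where
    at-root : ∀ {s′} → s′ ≡ s → Any (HasMeet (i s′) (j s′)) (node tl tr ∷ (ysl ++ zsl) ++ (ysr ++ zsr))
    at-root refl = Any.here (here , straddle⇒meet st)
    meets-grafted : ∀ s′ → i s′ ∈ leaves l ++ leaves r → j s′ ∈ leaves l ++ leaves r →
                    Any (HasMeet (i s′) (j s′)) (node tl tr ∷ (ysl ++ zsl) ++ (ysr ++ zsr))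
    meets-grafted s′ i∈ j∈ with ∈-++⁻ (leaves l) i∈ | ∈-++⁻ (leaves l) j∈
    ... | inj₁ il | inj₁ jl = graft-anyˡ ysl (meets Al s′ il jl)
    ... | inj₂ ir | inj₂ jr = graft-anyʳ ysl ysr (meets Ar s′ ir jr)
    ... | inj₁ il | inj₂ jr = at-root (only-s s′ (inj₁ (il , jr)))
    ... | inj₂ ir | inj₁ jl = at-root (only-s s′ (inj₂ (jl , ir)))

  graft-at : ∀ {p pl pr l r s Fl Fr} → ChildL p pl → ChildR p pr → Assembly pl l Fl → Assembly pr r Fr →
    Straddles s l r → (∀ s′ → Straddles s′ l r → s′ ≡ s) → Σ (Forest n) (Assembly p (node l r))
  graft-at {Fl = Fl} {Fr} hl hr Al Ar (inj₁ (il , jr)) only-s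
    with split-at-label {F = Fl} (∈-resp-↭ (↭-sym (labels↭ Al)) il)
       | split-at-label {F = Fr} (∈-resp-↭ (↭-sym (labels↭ Ar)) jr)
  ... | _ , ysl , _ , refl , i∈tl | _ , ysr , _ , refl , j∈tr =
    _ , graft ysl ysr hl hr Al Ar (inj₁ (i∈tl , j∈tr)) only-s
  graft-at {Fl = Fl} {Fr} hl hr Al Ar (inj₂ (jl , ir)) only-s
    with split-at-label {F = Fl} (∈-resp-↭ (↭-sym (labels↭ Al)) jl)
       | split-at-label {F = Fr} (∈-resp-↭ (↭-sym (labels↭ Ar)) ir)
  ... | _ , ysl , _ , refl , j∈tl | _ , ysr , _ , refl , i∈tr =
    _ , graft ysl ysr hl hr Al Ar (inj₂ (j∈tl , i∈tr)) only-s

  assemble : (t : Tree n) (p : Pos T) → subtreeAt T p ≡ t → Σ (Forest n) (Assembly p t)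
  assemble (leaf a) p e = [ leaf a ] , record
    { labels↭ = ↭-refl
    ; placed  = (p , desc-refl p , placed-leaf e) ∷ []
    ; meets   = λ s i∈ j∈ → ⊥-elim (i≢j s (trans (Anyₚ.singleton⁻ i∈) (sym (Anyₚ.singleton⁻ j∈))))
    }
  assemble (node l r) p e with childL-at p e | childR-at p e
  ... | pl , hl , el | pr , hr , er
    with assemble l pl el | assemble r pr er | any? (λ s → straddles? s l r)
  ...   | Fl , Al | Fr , Ar | no ¬st = Fl ++ Fr , juxtapose hl hr Al Ar (λ s st → ¬st (s , st))
  ...   | Fl , Al | Fr , Ar | yes (s , st) = graft-at hl hr Al Ar st only-s
    where
    only-s : ∀ s′ → Straddles s′ l r → s′ ≡ s
    only-s s′ st′ = distinct s′ s (zero , p) (straddle⇒vertex hl hr el er st′) (straddle⇒vertex hl hr el er st)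

  J₀-assembly : Σ (Forest n) (Assembly here T)
  J₀-assembly = assemble T here refl

  J₀ : Forest n
  J₀ = proj₁ J₀-assembly

  J₀-forestOn : IsForestOn J₀
  J₀-forestOn = ↭-trans (labels↭ (proj₂ J₀-assembly)) isT

  J₀-placed : (m : Fin (length J₀)) → Σ (Pos T) (Placed (lookup J₀ m))
  J₀-placed m = let (w , _ , g) = All.lookup (placed (proj₂ J₀-assembly)) (∈-lookup m) in w , g

  J₀-unique : Unique (labels J₀)
  J₀-unique = forestOn⇒unique J₀ J₀-forestOn

  place : ∀ {t w} → Placed t w → Pos t → Pos T
  place {w = w} _ here = w
  place (placed-node _ _ _ gl _) (left p)  = place gl p
  place (placed-node _ _ _ _ gr) (right p) = place gr p

  place-leaf : ∀ {t w a} (g : Placed t w) (p : Pos t) → subtreeAt t p ≡ leaf a → subtreeAt T (place g p) ≡ leaf a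
  place-leaf (placed-leaf e)          here      refl = e
  place-leaf (placed-node _ _ _ _ _)  here      ()
  place-leaf (placed-node _ _ _ gl _) (left p)  e    = place-leaf gl p e
  place-leaf (placed-node _ _ _ _ gr) (right p) e    = place-leaf gr p e

  place-inner : ∀ {t w} (g : Placed t w) (p : Pos t) → IsNode (subtreeAt t p) → IsNode (subtreeAt T (place g p))
  place-inner (placed-leaf _)          here      ()
  place-inner (placed-node _ _ f _ _)  here      _  = fork⇒node f
  place-inner (placed-node _ _ _ gl _) (left p)  nd = place-inner gl p nd
  place-inner (placed-node _ _ _ _ gr) (right p) nd = place-inner gr p nd

  place-edges : ∀ {t w} (g : Placed t w) {p cl cr : Pos t} → ChildL p cl → ChildR p cr →
    Fork (place g p) (place g cl) (place g cr)
  place-edges (placed-node _ _ f _ _)  cl-here      cr-here       = f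
  place-edges (placed-node _ _ _ gl _) (cl-left h)  (cr-left h′)  = place-edges gl h h′
  place-edges (placed-node _ _ _ _ gr) (cl-right h) (cr-right h′) = place-edges gr h h′

  placed-leaf-below : ∀ {t w a} → Placed t w → a ∈ leaves t →
    Σ (Pos T) λ q → Desc w q × subtreeAt T q ≡ leaf a
  placed-leaf-below (placed-leaf e) (Any.here refl) = _ , desc-refl _ , e
  placed-leaf-below (placed-node _ _ f gl gr) a∈ with ∈-++⁻ _ a∈
  ... | inj₁ a∈l = Product.map₂ (Product.map₁ (desc-trans (fork⇒descˡ f))) (placed-leaf-below gl a∈l)
  ... | inj₂ a∈r = Product.map₂ (Product.map₁ (desc-trans (fork⇒descʳ f))) (placed-leaf-below gr a∈r)

  placed-meet : ∀ {l r w a b} → Placed (node l r) w → a ∈ leaves l → b ∈ leaves r → Meet T a b w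
  placed-meet (placed-node _ _ f gl gr) a∈ b∈ with placed-leaf-below gl a∈ | placed-leaf-below gr b∈
  ... | p , dp , ep | q , dq , eq = p , q , ep , eq , fork-desc-trans f dp dq

  placed-vertex : ∀ {l r w s} → Placed (node l r) w → Straddles s l r → IsVertex T (i s) (j s) (zero , w)
  placed-vertex g (inj₁ (il , jr)) = meet⇒fmeet {F = [ T ]} (placed-meet g il jr)
  placed-vertex g (inj₂ (jl , ir)) = meet⇒fmeet {F = [ T ]} (meet-swap (placed-meet g jl ir))

  inner-label : ∀ {t w} → Placed t w → (p : Pos t) → IsNode (subtreeAt t p) →
    Σ (Fin k) λ s → Meet t (i s) (j s) p
  inner-label (placed-node s st _ _ _)  here      _  = s , straddle⇒meet st
  inner-label (placed-node _ _ _ gl _) (left p)  nd = Product.map₂ meet-left (inner-label gl p nd)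
  inner-label (placed-node _ _ _ _ gr) (right p) nd = Product.map₂ meet-right (inner-label gr p nd)

  embed : FPos J₀ → FPos [ T ]
  embed (m , p) = zero , place (proj₂ (J₀-placed m)) p

  embed-leaves : PreservesLeaves J₀ [ T ] embed
  embed-leaves (m , p) _ e = place-leaf (proj₂ (J₀-placed m)) p e

  embed-edges : PreservesEdges J₀ [ T ] embed
  embed-edges _ _ _ (mk {m} h) (mk h′) = fork⇒ffork (place-edges (proj₂ (J₀-placed m)) h h′)

  embed-inner : ∀ x → IsNode (FSub J₀ x) → IsNode (FSub [ T ] (embed x))
  embed-inner (m , p) = place-inner (proj₂ (J₀-placed m)) p

  J₀-inner-vertex : (x : FPos J₀) → IsNode (FSub J₀ x) →
    Σ (Fin k) λ s → FMeet J₀ (i s) (j s) x × IsVertex T (i s) (j s) (embed x)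
  J₀-inner-vertex (m , p) nx =
    let (s , meet) = inner-label (proj₂ (J₀-placed m)) p nx
        fmeet      = meet⇒fmeet {F = J₀} meet
    in s , fmeet , preserves-meet embed-edges embed-leaves fmeet

  embed-inner-injective : ∀ x y → IsNode (FSub J₀ x) → IsNode (FSub J₀ y) → embed x ≡ embed y → x ≡ y
  embed-inner-injective x y nx ny e with J₀-inner-vertex x nx | J₀-inner-vertex y ny
  ... | s , mx , vx | s′ , my , vy with distinct s s′ (embed x) vx (subst (IsVertex T (i s′) (j s′)) (sym e) vy)
  ...   | refl = fmeet-unique {F = J₀} J₀-unique mx my

  J₀≤T : J₀ ≤F [ T ]
  J₀≤T = embed , record
    { onLeaves = embed-leaves
    ; onInner  = embed-inner
    ; innerInj = embed-inner-injective
    ; onEdges  = embed-edges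
    }

  J₀-inInterval : InInterval T J₀
  J₀-inInterval = J₀-forestOn , zeroF-least J₀-forestOn , J₀≤T

  atom≤J₀ : ∀ s → atom (i s) (j s) ≤F J₀
  atom≤J₀ s =
    atom≤F J₀-forestOn (proj₂ (any-hasMeet⇒fmeet {F = J₀} (meets (proj₂ J₀-assembly) s (∈T (i s)) (∈T (j s)))))
    where
    ∈T : ∀ a → a ∈ leaves T
    ∈T a = ∈-resp-↭ (↭-sym isT) (∈-allFin a)

  module Minimal (F : Forest n) (isF : IsForestOn F) (χ : F ≤F [ T ]) (ψ : ∀ s → atom (i s) (j s) ≤F F) where

    private
      module χ = IsMorphism (proj₂ χ)

    root : Fin k → FPos F
    root s = proj₁ (ψ s) atomRoot

    root-fork : ∀ s → FFork F (root s) (leafOf F isF (i s)) (leafOf F isF (j s))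
    root-fork s with atom-root-meet (ψ s)
    ... | y , z , ey , ez , f = subst₂ (FFork F (root s)) (leafOf-unique F isF y ey) (leafOf-unique F isF z ez) f

    factor : ∀ {t w} → Placed t w → Pos t → FPos F
    factor (placed-leaf {a} _)      here      = leafOf F isF a
    factor (placed-node s _ _ _ _)  here      = root s
    factor (placed-node _ _ _ gl _) (left p)  = factor gl p
    factor (placed-node _ _ _ _ gr) (right p) = factor gr p

    χ-factor : ∀ {t w} (g : Placed t w) (p : Pos t) → proj₁ χ (factor g p) ≡ (zero , place g p)
    χ-factor (placed-leaf {a} e) here =
      fleaf-unique {F = [ T ]} T-unique _ _ (χ.onLeaves _ a (leafOf-leaf F isF a)) e
    χ-factor g@(placed-node s st _ _ _) here =
      fmeet-unique {F = [ T ]} T-unique (≤F-preserves-meet χ (atom-root-meet (ψ s))) (placed-vertex g st)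
    χ-factor (placed-node _ _ _ gl _) (left p)  = χ-factor gl p
    χ-factor (placed-node _ _ _ _ gr) (right p) = χ-factor gr p

    factor-above : ∀ {t w a} (g : Placed t w) → a ∈ leaves t → FDesc F (factor g here) (leafOf F isF a)
    factor-fork : ∀ {l r w} (g : Placed (node l r) w) →
      FFork F (factor g here) (factor g (left here)) (factor g (right here))
    below-root : ∀ {s t w w′ a} (g : Placed t w′) → Strict w w′ → proj₁ χ (root s) ≡ (zero , w) →
      FDesc F (root s) (leafOf F isF a) → a ∈ leaves t → FStrict F (root s) (factor g here)

    factor-above (placed-leaf _) (Any.here refl) = fdesc-refl _
    factor-above g@(placed-node _ _ _ gl gr) a∈ with ∈-++⁻ _ a∈
    ... | inj₁ a∈l = fdesc-trans (ffork⇒descˡ (factor-fork g)) (factor-above gl a∈l)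
    ... | inj₂ a∈r = fdesc-trans (ffork⇒descʳ (factor-fork g)) (factor-above gr a∈r)

    factor-fork g@(placed-node s (inj₁ (il , jr)) f gl gr) =
      ffork-between (root-fork s)
        (below-root gl (fork⇒strictˡ f) (χ-factor g here) (ffork⇒descˡ (root-fork s)) il) (factor-above gl il)
        (below-root gr (fork⇒strictʳ f) (χ-factor g here) (ffork⇒descʳ (root-fork s)) jr) (factor-above gr jr)
    factor-fork g@(placed-node s (inj₂ (jl , ir)) f gl gr) =
      ffork-between (ffork-swap (root-fork s))
        (below-root gl (fork⇒strictˡ f) (χ-factor g here) (ffork⇒descʳ (root-fork s)) jl) (factor-above gl jl)
        (below-root gr (fork⇒strictʳ f) (χ-factor g here) (ffork⇒descˡ (root-fork s)) ir) (factor-above gr ir)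

    below-root g w<w′ χroot d a∈ =
      reflects-strict χ.onEdges d (factor-above g a∈)
        (subst₂ (FStrict [ T ]) (sym χroot) (sym (χ-factor g here)) (strict⇒fstrict w<w′))

    factor-leaf : ∀ {t w a} (g : Placed t w) (p : Pos t) → subtreeAt t p ≡ leaf a → FSub F (factor g p) ≡ leaf a
    factor-leaf (placed-leaf _)          here      refl = leafOf-leaf F isF _
    factor-leaf (placed-node _ _ _ _ _)  here      ()
    factor-leaf (placed-node _ _ _ gl _) (left p)  e    = factor-leaf gl p e
    factor-leaf (placed-node _ _ _ _ gr) (right p) e    = factor-leaf gr p e

    factor-inner : ∀ {t w} (g : Placed t w) (p : Pos t) → IsNode (subtreeAt t p) → IsNode (FSub F (factor g p))
    factor-inner (placed-leaf _)            here      ()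
    factor-inner g@(placed-node _ _ _ _ _)  here      _  = ffork⇒node (factor-fork g)
    factor-inner (placed-node _ _ _ gl _)   (left p)  nd = factor-inner gl p nd
    factor-inner (placed-node _ _ _ _ gr)   (right p) nd = factor-inner gr p nd

    factor-edges : ∀ {t w} (g : Placed t w) {p cl cr : Pos t} → ChildL p cl → ChildR p cr →
      FFork F (factor g p) (factor g cl) (factor g cr)
    factor-edges g@(placed-node _ _ _ _ _) cl-here      cr-here       = factor-fork g
    factor-edges (placed-node _ _ _ gl _)  (cl-left h)  (cr-left h′)  = factor-edges gl h h′
    factor-edges (placed-node _ _ _ _ gr)  (cl-right h) (cr-right h′) = factor-edges gr h h′

    α : FPos J₀ → FPos F
    α (m , p) = factor (proj₂ (J₀-placed m)) p

    χ∘α : ∀ x → proj₁ χ (α x) ≡ embed x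
    χ∘α (m , p) = χ-factor (proj₂ (J₀-placed m)) p

    J₀≤F : J₀ ≤F F
    J₀≤F = α , record
      { onLeaves = λ { (m , p) _ e → factor-leaf (proj₂ (J₀-placed m)) p e }
      ; onInner  = λ { (m , p) → factor-inner (proj₂ (J₀-placed m)) p }
      ; innerInj = λ x y nx ny e →
          embed-inner-injective x y nx ny (trans (sym (χ∘α x)) (trans (cong (proj₁ χ) e) (χ∘α y)))
      ; onEdges  = λ { _ _ _ (mk {m} h) (mk h′) → factor-edges (proj₂ (J₀-placed m)) h h′ }
      }

  J₀-isJoin : IsJoinIn T (λ s → atom (i s) (j s)) J₀
  J₀-isJoin = J₀-inInterval , atom≤J₀ , λ F (isF , _ , χ) ψ → Minimal.J₀≤F F isF χ ψ

  join-vertices : ∀ J → IsJoinIn T (λ s → atom (i s) (j s)) J → (φ : J ≤F [ T ]) →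
    ∀ x → (Σ (FPos J) λ y → IsNode (FSub J y) × proj₁ φ y ≡ x)
        ⇔ (Σ (Fin k) λ s → IsVertex T (i s) (j s) x)
  join-vertices J (_ , atom≤J , least) φ x = mk⇔ to from
    where
    μ : J ≤F J₀
    μ = least J₀ J₀-inInterval atom≤J₀
    to : Σ (FPos J) (λ y → IsNode (FSub J y) × proj₁ φ y ≡ x) → Σ (Fin k) λ s → IsVertex T (i s) (j s) x
    to (y , ny , φy≡x) =
      let (s , _ , v) = J₀-inner-vertex (proj₁ μ y) (IsMorphism.onInner (proj₂ μ) y ny)
          φy≡embed    = ≤F-unique T-unique φ (≤F-trans μ J₀≤T) y
      in s , subst (IsVertex T (i s) (j s)) (trans (sym φy≡embed) φy≡x) v
    from : Σ (Fin k) (λ s → IsVertex T (i s) (j s) x) → Σ (FPos J) λ y → IsNode (FSub J y) × proj₁ φ y ≡ x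
    from (s , v) =
      proj₁ (atom≤J s) atomRoot ,
      IsMorphism.onInner (proj₂ (atom≤J s)) atomRoot isNode ,
      fmeet-unique {F = [ T ]} T-unique (≤F-preserves-meet φ (atom-root-meet (atom≤J s))) v

mainTheorem9 : ∀ {n k : ℕ} (T : Tree n) → IsTreeOn T →
    (i j : Fin k → Fin n) → (∀ r → i r ≢ j r) →
    (∀ r s x → IsVertex T (i r) (j r) x → IsVertex T (i s) (j s) x → r ≡ s) →
    Σ (Forest n) (IsJoinIn T (λ r → atom (i r) (j r)))
    × (∀ J → IsJoinIn T (λ r → atom (i r) (j r)) J → (φ : J ≤F [ T ]) →
    ∀ x → (Σ (FPos J) (λ y → IsNode (FSub J y) × proj₁ φ y ≡ x))
    ⇔ (Σ (Fin k) (λ r → IsVertex T (i r) (j r) x)))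
mainTheorem9 T isT i j i≢j distinct = (J₀ , J₀-isJoin) , join-vertices
  where open JoinOfAtoms T isT i j i≢j distinct
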